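{- Let $\mathcal{S}$ be a degree sequence with a realizing topological ordering $\phi=v_1,\ldots,v_n$, and let $1\le i<j<k\le n$ be positions with $p_i=p_j=p_k$. Then $\phi[1,i]\phi[j+1,k]\phi[i+1,j]\phi[k+1,n]$ is a realizing topological ordering for $\mathcal{S}$.
   Context: A degree sequence is a multiset of pairs $\binom{a}{b}$ of nonnegative integers ($a$ indegree, $b$ outdegree), all at most a fixed positive integer $\Delta$. A dag (directed acyclic graph without parallel arcs and self-loops) realizes it if its vertices are in bijection with the elements with matching in/outdegrees. A realizing topological ordering for $\mathcal{S}$ is a topological ordering (all arcs go forward) of a dag realizing $\mathcal{S}$; a sequence of vertices with prescribed degrees is a realizing topological ordering for $\mathcal{S}$ if some dag realizing $\mathcal{S}$ with these vertex degrees has it as topological ordering. $\phi[i,j]=v_i,\ldots,v_j$; juxtaposition is concatenation. Potential at position $0\le i\le n$: $p_i\in\mathbb{N}^\Delta$ with $p_i[l]$ the number of vertices among $v_1,\ldots,v_i$ with at least $l$ neighbors among $v_{i+1},\ldots,v_n$ (with respect to the realizing dag of $\phi$). -}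

module Defs where

open import Data.Nat using (ℕ; zero; suc; _+_; _∸_; _≤_; _<ᵇ_; _≤ᵇ_)
open import Data.Bool using (Bool; true; false; if_then_else_; _∧_; _∨_)
open import Data.Fin as Fin using (Fin; toℕ)
open import Data.Product using (_×_; _,_; Σ; proj₁; proj₂)
open import Data.List using (List; length; lookup; take; drop; _++_)
open import Data.List.Relation.Unary.All using (All)
open import Data.List.Relation.Binary.Permutation.Propositional using (_↭_)
open import Relation.Binary.PropositionalEquality using (_≡_)

count : ∀ {n} → (Fin n → Bool) → ℕ
count {zero}  f = 0
count {suc n} f = (if f Fin.zero then 1 else 0) + count (λ x → f (Fin.suc x))

-- A degree sequence with bound Δ: a multiset (list up to permutation) of
-- pairs (indegree , outdegree), all entries at most Δ.
DegreeSequence : ℕ → List (ℕ × ℕ) → Set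
DegreeSequence Δ S = All (λ d → proj₁ d ≤ Δ × proj₂ d ≤ Δ) S

-- A dag on the vertices v_1..v_n of a sequence φ of prescribed degrees,
-- having φ as topological ordering: every arc goes forward (so there are
-- no self-loops; arcs form a relation, so no parallel arcs), and vertex v
-- has indegree / outdegree as prescribed by φ.
record TopDag (φ : List (ℕ × ℕ)) : Set where
  field
    arc      : Fin (length φ) → Fin (length φ) → Bool
    forward  : ∀ u v → arc u v ≡ true → u Fin.< v
    degrees  : ∀ v → lookup φ v ≡ (count (λ u → arc u v) , count (λ w → arc v w))
open TopDag public

RealizingTopOrd : List (ℕ × ℕ) → List (ℕ × ℕ) → Set
RealizingTopOrd S φ = (φ ↭ S) × TopDag φ

-- Potential at position i (w.r.t. dag D), component l (l ≥ 1):
-- number of vertices among v_1..v_i with at least l neighbours among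
-- v_{i+1}..v_n.
potential : ∀ {φ} → TopDag φ → ℕ → ℕ → ℕ
potential {φ} D i l =
  count (λ u → (toℕ u <ᵇ i) ∧
               (l ≤ᵇ count (λ w → (arc D u w ∧ (i ≤ᵇ toℕ w)) ∨
                                  (arc D w u ∧ (i ≤ᵇ toℕ w)))))

SamePotential : ∀ {φ} → ℕ → TopDag φ → ℕ → ℕ → Set
SamePotential {φ} Δ D i j = (l : Fin Δ) → potential D i (suc (toℕ l)) ≡ potential D j (suc (toℕ l))

-- φ[a,b] = v_a .. v_b (1-based, inclusive)
segment : List (ℕ × ℕ) → ℕ → ℕ → List (ℕ × ℕ)
segment φ a b = take (b ∸ (a ∸ 1)) (drop (a ∸ 1) φ)

-- Call the residual at t of a vertex among v_1..v_t its number of out-arcs into v_{t+1}..v_n;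
-- in a topological ordering these are all its neighbours there, so p_t[l] counts the residuals
-- ≥ l, and since residuals are at most Δ the potential p_t determines the profile at t: how
-- many earlier vertices have residual v, for each v ≥ 1. Build a dag on the new ordering
-- greedily: the vertex placed for old position t takes, for each v ≥ 1, as many in-neighbours
-- of residual v among the placed vertices as v_t had. This is possible, and keeps the profiles
-- equal, as long as the placed vertices have the profile of some old prefix v_1..v_t and the
-- next vertex is v_{t+1}. The new ordering runs through φ[1,i], φ[j+1,k], φ[i+1,j], φ[k+1,n],
-- and its three jumps (i to j, k to i, j to k) are between positions of equal potential. At the
-- end no residual is left, so every vertex has its out-degree; its in-degree is the total demand.

module Submission where

open import Defs
import Algebra.Properties.CommutativeSemigroup as CommutativeSemigroupProperties
open import Data.Bool using (Bool; true; false; if_then_else_; _∧_; _∨_)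
open import Data.Bool.Properties using (T-≡; ∧-identityʳ; ∧-zeroʳ; ∨-identityʳ)
open import Data.Empty using (⊥-elim)
open import Data.Fin as Fin using (Fin; toℕ; fromℕ<)
open import Data.Fin.Properties using (toℕ-fromℕ<; toℕ<n)
open import Data.List using (List; []; _∷_; length; lookup; take; drop; _++_)
open import Data.List.Properties using (length-++; length-take; length-drop; take++drop≡id; drop-drop; take-all)
open import Data.List.Relation.Unary.All as All using (All)
open import Data.List.Relation.Binary.Permutation.Propositional using (↭-trans; ↭-sym; ↭-reflexive)
open import Data.List.Relation.Binary.Permutation.Propositional.Properties using (All-resp-↭; ++⁺ˡ; shifts; ↭-length)
open import Data.Nat
  using (ℕ; zero; suc; _+_; _∸_; _⊓_; _≤_; _<_; z≤n; s≤s; s≤s⁻¹; _≤ᵇ_; _<ᵇ_; _≡ᵇ_; _≟_; _<?_; _≤?_)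
open import Data.Nat.Properties
open import Data.Nat.Solver using (module +-*-Solver)
open import Data.Product using (Σ; _×_; _,_; proj₁; proj₂; map₂)
open import Data.Sum using (inj₁; inj₂)
open import Function using (_∘_; Equivalence)
open import Relation.Binary.PropositionalEquality
open import Relation.Nullary using (¬_; yes; no)

open CommutativeSemigroupProperties +-commutativeSemigroup using (interchange)
open Equivalence using (to; from)

b2n : Bool → ℕ
b2n true  = 1
b2n false = 0

b2n≤1 : ∀ b → b2n b ≤ 1
b2n≤1 true  = ≤-refl
b2n≤1 false = z≤n

∧≡true⇒ˡ : ∀ {a b} → (a ∧ b) ≡ true → a ≡ true
∧≡true⇒ˡ {true} _ = refl

∧≡true⇒ʳ : ∀ {a b} → (a ∧ b) ≡ true → b ≡ true
∧≡true⇒ʳ {true} e = e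

≡ᵇ-refl : ∀ n → (n ≡ᵇ n) ≡ true
≡ᵇ-refl n = to T-≡ (≡⇒≡ᵇ n n refl)

≢⇒≡ᵇ≡false : ∀ {m n} → ¬ m ≡ n → (m ≡ᵇ n) ≡ false
≢⇒≡ᵇ≡false {m} {n} m≢n with m ≡ᵇ n in e
... | false = refl
... | true  = ⊥-elim (m≢n (≡ᵇ⇒≡ m n (from T-≡ e)))

≡ᵇ-sym : ∀ m n → (m ≡ᵇ n) ≡ (n ≡ᵇ m)
≡ᵇ-sym zero    zero    = refl
≡ᵇ-sym zero    (suc n) = refl
≡ᵇ-sym (suc m) zero    = refl
≡ᵇ-sym (suc m) (suc n) = ≡ᵇ-sym m n

<⇒<ᵇ≡true : ∀ {m n} → m < n → (m <ᵇ n) ≡ true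
<⇒<ᵇ≡true = to T-≡ ∘ <⇒<ᵇ

≥⇒<ᵇ≡false : ∀ {m n} → n ≤ m → (m <ᵇ n) ≡ false
≥⇒<ᵇ≡false {m} {n} n≤m with m <ᵇ n in e
... | false = refl
... | true  = ⊥-elim (<⇒≱ (<ᵇ⇒< m n (from T-≡ e)) n≤m)

<ᵇ≡true⇒< : ∀ {m n} → (m <ᵇ n) ≡ true → m < n
<ᵇ≡true⇒< {m} {n} = <ᵇ⇒< m n ∘ from T-≡

≤⇒≤ᵇ≡true : ∀ {m n} → m ≤ n → (m ≤ᵇ n) ≡ true
≤⇒≤ᵇ≡true = to T-≡ ∘ ≤⇒≤ᵇ

>⇒≤ᵇ≡false : ∀ {m n} → n < m → (m ≤ᵇ n) ≡ false
>⇒≤ᵇ≡false {suc m} (s≤s n≤m) = ≥⇒<ᵇ≡false n≤m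

≤ᵇ≡true⇒≤ : ∀ {m n} → (m ≤ᵇ n) ≡ true → m ≤ n
≤ᵇ≡true⇒≤ {m} {n} = ≤ᵇ⇒≤ m n ∘ from T-≡

<ᵇ-suc : ∀ m n → (m <ᵇ suc n) ≡ (m ≤ᵇ n)
<ᵇ-suc zero    n = refl
<ᵇ-suc (suc m) n = refl

≤ᵇ-split : ∀ m n → b2n (m ≤ᵇ n) ≡ b2n (m <ᵇ n) + b2n (m ≡ᵇ n)
≤ᵇ-split zero    zero    = refl
≤ᵇ-split zero    (suc n) = refl
≤ᵇ-split (suc m) zero    = refl
≤ᵇ-split (suc m) (suc n) = trans (cong b2n (<ᵇ-suc m n)) (≤ᵇ-split m n)

countBelow : ℕ → (ℕ → Bool) → ℕ
countBelow zero    f = 0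
countBelow (suc m) f = countBelow m f + b2n (f m)

countBelow-cong : ∀ m {f g} → (∀ x → x < m → f x ≡ g x) → countBelow m f ≡ countBelow m g
countBelow-cong zero    _ = refl
countBelow-cong (suc m) p =
  cong₂ _+_ (countBelow-cong m (λ x → p x ∘ m<n⇒m<1+n)) (cong b2n (p m (n<1+n m)))

countBelow-false : ∀ m {f} → (∀ x → x < m → f x ≡ false) → countBelow m f ≡ 0
countBelow-false zero    _ = refl
countBelow-false (suc m) p =
  cong₂ _+_ (countBelow-false m (λ x → p x ∘ m<n⇒m<1+n)) (cong b2n (p m (n<1+n m)))

countBelow-split : ∀ m (f g h : ℕ → Bool) →
  (∀ x → x < m → b2n (f x) ≡ b2n (g x) + b2n (h x)) →
  countBelow m f ≡ countBelow m g + countBelow m h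
countBelow-split zero    f g h p = refl
countBelow-split (suc m) f g h p =
  trans (cong₂ _+_ (countBelow-split m f g h (λ x → p x ∘ m<n⇒m<1+n)) (p m (n<1+n m)))
        (interchange (countBelow m g) (countBelow m h) (b2n (g m)) (b2n (h m)))

countBelow-interchange : ∀ m (f g h k : ℕ → Bool) →
  (∀ x → x < m → b2n (f x) + b2n (g x) ≡ b2n (h x) + b2n (k x)) →
  countBelow m f + countBelow m g ≡ countBelow m h + countBelow m k
countBelow-interchange zero    f g h k p = refl
countBelow-interchange (suc m) f g h k p =
  trans (interchange (countBelow m f) (b2n (f m)) (countBelow m g) (b2n (g m)))
    (trans (cong₂ _+_ (countBelow-interchange m f g h k (λ x → p x ∘ m<n⇒m<1+n)) (p m (n<1+n m)))
           (interchange (countBelow m h) (countBelow m k) (b2n (h m)) (b2n (k m))))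

countBelow-≤ : ∀ m f → countBelow m f ≤ m
countBelow-≤ zero    f = z≤n
countBelow-≤ (suc m) f = ≤-trans (+-mono-≤ (countBelow-≤ m f) (b2n≤1 (f m))) (≤-reflexive (+-comm m 1))

countBelow-mono : ∀ m {f g} → (∀ x → x < m → f x ≡ true → g x ≡ true) → countBelow m f ≤ countBelow m g
countBelow-mono zero    _ = z≤n
countBelow-mono (suc m) {f} {g} p =
  +-mono-≤ (countBelow-mono m (λ x → p x ∘ m<n⇒m<1+n)) (b2n-mono (p m (n<1+n m)))
  where
  b2n-mono : ∀ {a b} → (a ≡ true → b ≡ true) → b2n a ≤ b2n b
  b2n-mono {false} _ = z≤n
  b2n-mono {true}  q rewrite q refl = ≤-refl

countBelow-positive : ∀ m {f} x → x < m → f x ≡ true → 1 ≤ countBelow m f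
countBelow-positive (suc m) {f} x x<1+m fx with m≤n⇒m<n∨m≡n (s≤s⁻¹ x<1+m)
... | inj₁ x<m = ≤-trans (countBelow-positive m x x<m fx) (m≤m+n _ _)
... | inj₂ refl rewrite fx = m≤n+m 1 (countBelow m f)

countBelow-beyond : ∀ {t} n f → t ≤ n → (∀ x → t ≤ x → f x ≡ false) → countBelow n f ≡ countBelow t f
countBelow-beyond {t} n f t≤n p with t ≟ n
... | yes refl = refl
countBelow-beyond zero    f z≤n   _ | no 0≢0   = ⊥-elim (0≢0 refl)
countBelow-beyond {t} (suc n) f t≤1+n p | no t≢1+n =
  trans (cong₂ _+_ (countBelow-beyond n f t≤n p) (cong b2n (p n t≤n))) (+-identityʳ _)
  where
  t≤n : t ≤ n
  t≤n = s≤s⁻¹ (≤∧≢⇒< t≤1+n t≢1+n)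

countBelow-single : ∀ n t (f : ℕ → Bool) → t < n → countBelow n (λ w → f w ∧ (t ≡ᵇ w)) ≡ b2n (f t)
countBelow-single n t f t<n =
  begin
    countBelow n (λ w → f w ∧ (t ≡ᵇ w))
  ≡⟨ countBelow-beyond n _ t<n (λ x t<x → off x (<⇒≢ t<x)) ⟩
    countBelow t (λ w → f w ∧ (t ≡ᵇ w)) + b2n (f t ∧ (t ≡ᵇ t))
  ≡⟨ cong₂ _+_ (countBelow-false t (λ x x<t → off x (≢-sym (<⇒≢ x<t))))
               (cong (b2n ∘ (f t ∧_)) (≡ᵇ-refl t)) ⟩
    b2n (f t ∧ true)
  ≡⟨ cong b2n (∧-identityʳ (f t)) ⟩
    b2n (f t)
  ∎
  where
  open ≡-Reasoning
  off : ∀ x → ¬ t ≡ x → f x ∧ (t ≡ᵇ x) ≡ false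
  off x t≢x = trans (cong (f x ∧_) (≢⇒≡ᵇ≡false t≢x)) (∧-zeroʳ (f x))

countBelow-cons : ∀ m f → countBelow (suc m) f ≡ b2n (f 0) + countBelow m (f ∘ suc)
countBelow-cons zero    f = +-comm 0 (b2n (f 0))
countBelow-cons (suc m) f =
  trans (cong (_+ b2n (f (suc m))) (countBelow-cons m f)) (+-assoc (b2n (f 0)) _ _)

count≡countBelow : ∀ {n} (f : Fin n → Bool) (F : ℕ → Bool) → (∀ u → f u ≡ F (toℕ u)) →
  count f ≡ countBelow n F
count≡countBelow {zero}  f F p = refl
count≡countBelow {suc n} f F p =
  trans (cong₂ _+_ (if-b2n (p Fin.zero)) (count≡countBelow (f ∘ Fin.suc) (F ∘ suc) (p ∘ Fin.suc)))
        (sym (countBelow-cons n F))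
  where
  if-b2n : ∀ {a b} → a ≡ b → (if a then 1 else 0) ≡ b2n b
  if-b2n {true}  refl = refl
  if-b2n {false} refl = refl

countBelow-first : ∀ m K (f : ℕ → Bool) →
  countBelow m (λ x → f x ∧ (countBelow x f <ᵇ K)) ≡ K ⊓ countBelow m f
countBelow-first zero    K f = sym (⊓-zeroʳ K)
countBelow-first (suc m) K f with f m
... | false = trans (+-identityʳ _) (trans (countBelow-first m K f) (cong (K ⊓_) (sym (+-identityʳ _))))
... | true with countBelow m f <? K
...   | yes c<K rewrite <⇒<ᵇ≡true c<K =
        trans (cong (_+ 1) (trans (countBelow-first m K f) (m≥n⇒m⊓n≡n (<⇒≤ c<K))))
              (sym (m≥n⇒m⊓n≡n (subst (_≤ K) (+-comm 1 _) c<K)))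
...   | no c≮K rewrite ≥⇒<ᵇ≡false (≮⇒≥ c≮K) =
        trans (+-identityʳ _)
          (trans (countBelow-first m K f)
            (trans (m≤n⇒m⊓n≡m (≮⇒≥ c≮K))
              (sym (m≤n⇒m⊓n≡m (≤-trans (≮⇒≥ c≮K) (m≤m+n _ 1))))))

b2n-∧-split : ∀ a {b c d} → b2n b ≡ b2n c + b2n d → b2n (a ∧ b) ≡ b2n (a ∧ c) + b2n (a ∧ d)
b2n-∧-split true  e = e
b2n-∧-split false _ = refl

countBelow-byValue : ∀ m t B (f g : ℕ → Bool) (r s : ℕ → ℕ) →
  (∀ x → x < m → r x ≤ B) → (∀ y → y < t → s y ≤ B) →
  (∀ v → countBelow m (λ x → f x ∧ (r x ≡ᵇ v)) ≡ countBelow t (λ y → g y ∧ (s y ≡ᵇ v))) →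
  countBelow m f ≡ countBelow t g
countBelow-byValue m t B f g r s r≤B s≤B byValue =
  begin
    countBelow m f                         ≡⟨ countBelow-cong m (λ x → bounded f r ∘ r≤B x) ⟩
    countBelow m (λ x → f x ∧ (r x ≤ᵇ B))  ≡⟨ upTo B ⟩
    countBelow t (λ y → g y ∧ (s y ≤ᵇ B))  ≡⟨ countBelow-cong t (λ y → bounded g s ∘ s≤B y) ⟨
    countBelow t g
  ∎
  where
  open ≡-Reasoning
  bounded : ∀ (h : ℕ → Bool) (q : ℕ → ℕ) {x} → q x ≤ B → h x ≡ h x ∧ (q x ≤ᵇ B)
  bounded h q {x} q≤B = trans (sym (∧-identityʳ (h x))) (cong (h x ∧_) (sym (≤⇒≤ᵇ≡true q≤B)))
  ≤ᵇ0 : ∀ a → (a ≤ᵇ 0) ≡ (a ≡ᵇ 0)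
  ≤ᵇ0 zero    = refl
  ≤ᵇ0 (suc a) = refl
  peel : ∀ n (h : ℕ → Bool) (q : ℕ → ℕ) b →
    countBelow n (λ x → h x ∧ (q x ≤ᵇ suc b)) ≡
    countBelow n (λ x → h x ∧ (q x ≤ᵇ b)) + countBelow n (λ x → h x ∧ (q x ≡ᵇ suc b))
  peel n h q b = countBelow-split n _ _ _ (λ x _ → b2n-∧-split (h x)
    (trans (≤ᵇ-split (q x) (suc b)) (cong (λ c → b2n c + b2n (q x ≡ᵇ suc b)) (<ᵇ-suc (q x) b))))
  upTo : ∀ b → countBelow m (λ x → f x ∧ (r x ≤ᵇ b)) ≡ countBelow t (λ y → g y ∧ (s y ≤ᵇ b))
  upTo zero =
    trans (countBelow-cong m (λ x _ → cong (f x ∧_) (≤ᵇ0 (r x))))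
      (trans (byValue 0) (sym (countBelow-cong t (λ y _ → cong (g y ∧_) (≤ᵇ0 (s y))))))
  upTo (suc b) =
    trans (peel m f r b) (trans (cong₂ _+_ (upTo b) (byValue (suc b))) (sym (peel t g s b)))

countBelow-decrement : ∀ m (r : ℕ → ℕ) (s : ℕ → Bool) v → (∀ x → x < m → s x ≡ true → 1 ≤ r x) →
  countBelow m (λ x → (r x ∸ b2n (s x)) ≡ᵇ v) + countBelow m (λ x → s x ∧ (r x ≡ᵇ v)) ≡
  countBelow m (λ x → r x ≡ᵇ v) + countBelow m (λ x → s x ∧ (r x ≡ᵇ suc v))
countBelow-decrement m r s v p = countBelow-interchange m _ _ _ _ (λ x x<m → pointwise (r x) (s x) (p x x<m))
  where
  pointwise : ∀ r s → (s ≡ true → 1 ≤ r) →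
    b2n ((r ∸ b2n s) ≡ᵇ v) + b2n (s ∧ (r ≡ᵇ v)) ≡ b2n (r ≡ᵇ v) + b2n (s ∧ (r ≡ᵇ suc v))
  pointwise r       false _ = refl
  pointwise zero    true  p with p refl
  ... | ()
  pointwise (suc r) true  _ = +-comm (b2n (r ≡ᵇ v)) _

module Residuals (n : ℕ) (G : ℕ → ℕ → Bool) (G-forward : ∀ x y → G x y ≡ true → x < y) where

  outdeg indeg : ℕ → ℕ
  outdeg x = countBelow n (G x)
  indeg  y = countBelow n (λ x → G x y)

  -- Positions are 0-based: residual t x is the number of out-neighbours of v_{x+1} among
  -- v_{t+1}..v_n, so atLeast t l is p_t[l] (potential≡atLeast).
  residual : ℕ → ℕ → ℕ
  residual t x = countBelow n (λ w → G x w ∧ (t ≤ᵇ w))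

  profile : ℕ → ℕ → ℕ
  profile t v = countBelow t (λ x → residual t x ≡ᵇ v)

  demand : ℕ → ℕ → ℕ
  demand t v = countBelow t (λ x → G x t ∧ (residual t x ≡ᵇ v))

  atLeast : ℕ → ℕ → ℕ
  atLeast t l = countBelow t (λ x → l ≤ᵇ residual t x)

  SameProfile : ℕ → ℕ → Set
  SameProfile t t′ = ∀ v → profile t (suc v) ≡ profile t′ (suc v)

  no-backward-arc : ∀ {x y} → y ≤ x → G x y ≡ false
  no-backward-arc {x} {y} y≤x with G x y in e
  ... | false = refl
  ... | true  = ⊥-elim (<⇒≱ (G-forward x y e) y≤x)

  residual≤outdeg : ∀ t x → residual t x ≤ outdeg x
  residual≤outdeg t x = countBelow-mono n (λ _ _ → ∧≡true⇒ˡ)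

  residual-positive : ∀ {t x} → t < n → G x t ≡ true → 1 ≤ residual t x
  residual-positive {t} t<n e = countBelow-positive n t t<n (cong₂ _∧_ e (≤⇒≤ᵇ≡true (≤-refl {t})))

  residual-suc : ∀ {t} x → t < n → residual (suc t) x ≡ residual t x ∸ b2n (G x t)
  residual-suc {t} x t<n = sym (trans (cong (_∸ b2n (G x t)) split) (m+n∸n≡m _ (b2n (G x t))))
    where
    split : residual t x ≡ residual (suc t) x + b2n (G x t)
    split = trans (countBelow-split n _ _ _ (λ w _ → b2n-∧-split (G x w) (≤ᵇ-split t w)))
                  (cong (residual (suc t) x +_) (countBelow-single n t (G x) t<n))

  residual-self : ∀ t → residual (suc t) t ≡ outdeg t
  residual-self t = countBelow-cong n pointwise
    where
    pointwise : ∀ w → w < n → (G t w ∧ (suc t ≤ᵇ w)) ≡ G t w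
    pointwise w _ with G t w in e
    ... | false = refl
    ... | true  = ≤⇒≤ᵇ≡true (G-forward t w e)

  profile-end : ∀ v → profile n (suc v) ≡ 0
  profile-end v = countBelow-false n (λ x _ → cong (_≡ᵇ suc v) residual-end)
    where
    residual-end : ∀ {x} → residual n x ≡ 0
    residual-end {x} =
      countBelow-false n (λ w w<n → trans (cong (G x w ∧_) (>⇒≤ᵇ≡false w<n)) (∧-zeroʳ (G x w)))

  demand≤profile : ∀ t v → demand t v ≤ profile t v
  demand≤profile t v = countBelow-mono t (λ x _ → ∧≡true⇒ʳ {G x t})

  demand-zero : ∀ {t} → t < n → demand t 0 ≡ 0
  demand-zero {t} t<n = countBelow-false t pointwise
    where
    pointwise : ∀ x → x < t → G x t ∧ (residual t x ≡ᵇ 0) ≡ false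
    pointwise x _ with G x t in e
    ... | false = refl
    ... | true  = ≢⇒≡ᵇ≡false (λ r≡0 → <⇒≢ (residual-positive t<n e) (sym r≡0))

  atLeast-split : ∀ t v → atLeast t v ≡ profile t v + atLeast t (suc v)
  atLeast-split t v = countBelow-split t _ _ _ (λ x _ →
    trans (≤ᵇ-split v (residual t x))
      (trans (+-comm (b2n (v <ᵇ residual t x)) _)
        (cong (λ c → b2n c + b2n (v <ᵇ residual t x)) (≡ᵇ-sym v (residual t x)))))

  atLeast-vanishes : ∀ t l → (∀ x → x < t → residual t x < l) → atLeast t l ≡ 0
  atLeast-vanishes t l r<l = countBelow-false t (λ x → >⇒≤ᵇ≡false ∘ r<l x)

  sameAtLeast⇒SameProfile : ∀ t t′ → (∀ l → atLeast t (suc l) ≡ atLeast t′ (suc l)) → SameProfile t t′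
  sameAtLeast⇒SameProfile t t′ same v = +-cancelʳ-≡ (atLeast t (suc (suc v))) _ _ (
    begin
      profile t (suc v) + atLeast t (suc (suc v))    ≡⟨ atLeast-split t (suc v) ⟨
      atLeast t (suc v)                              ≡⟨ same v ⟩
      atLeast t′ (suc v)                             ≡⟨ atLeast-split t′ (suc v) ⟩
      profile t′ (suc v) + atLeast t′ (suc (suc v))  ≡⟨ cong (profile t′ (suc v) +_) (same (suc v)) ⟨
      profile t′ (suc v) + atLeast t (suc (suc v))
    ∎)
    where open ≡-Reasoning

-- New vertex m stands for old vertex π m. At stage m it takes as in-neighbours, for each
-- v ≥ 1, the first demand (π m) v earlier new vertices that still have v out-arcs to place.
module Greedy (n : ℕ) (G : ℕ → ℕ → Bool) (G-forward : ∀ x y → G x y ≡ true → x < y) (π : ℕ → ℕ) where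
  open Residuals n G G-forward

  target : ℕ → ℕ
  target x = outdeg (π x)

  mutual
    arcs : ℕ → ℕ → ℕ → Bool
    arcs zero    x y = false
    arcs (suc m) x y = if y ≡ᵇ m then chosen m x else arcs m x y

    left : ℕ → ℕ → ℕ
    left m x = target x ∸ countBelow m (arcs m x)

    chosen : ℕ → ℕ → Bool
    chosen m x = (x <ᵇ m) ∧ ((1 ≤ᵇ left m x) ∧
                 (countBelow x (λ y → left m y ≡ᵇ left m x) <ᵇ demand (π m) (left m x)))

  newProfile : ℕ → ℕ → ℕ
  newProfile m v = countBelow m (λ x → left m x ≡ᵇ v)

  Matches : ℕ → ℕ → Set
  Matches m t = ∀ v → newProfile m (suc v) ≡ profile t (suc v)

  chosen⇒< : ∀ m x → chosen m x ≡ true → x < m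
  chosen⇒< m x e = <ᵇ≡true⇒< (∧≡true⇒ˡ e)

  chosen⇒left-positive : ∀ m x → chosen m x ≡ true → 1 ≤ left m x
  chosen⇒left-positive m x e = ≤ᵇ≡true⇒≤ (∧≡true⇒ˡ (∧≡true⇒ʳ {x <ᵇ m} e))

  chosen-self : ∀ m → chosen m m ≡ false
  chosen-self m rewrite ≥⇒<ᵇ≡false (≤-refl {m}) = refl

  arcs⇒forward : ∀ m x y → arcs m x y ≡ true → x < y × y < m
  arcs⇒forward (suc m) x y e with y ≟ m
  ... | yes refl rewrite ≡ᵇ-refl y = chosen⇒< m x e , n<1+n m
  ... | no  y≢m  rewrite ≢⇒≡ᵇ≡false y≢m = map₂ m<n⇒m<1+n (arcs⇒forward m x y e)

  arcs-new : ∀ m x → arcs (suc m) x m ≡ chosen m x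
  arcs-new m x rewrite ≡ᵇ-refl m = refl

  arcs-suc : ∀ m x y → y < m → arcs (suc m) x y ≡ arcs m x y
  arcs-suc m x y y<m rewrite ≢⇒≡ᵇ≡false (<⇒≢ y<m) = refl

  arcs-+ : ∀ m d x y → y < m → arcs (m + d) x y ≡ arcs m x y
  arcs-+ m zero    x y y<m = cong (λ m′ → arcs m′ x y) (+-identityʳ m)
  arcs-+ m (suc d) x y y<m =
    trans (cong (λ m′ → arcs m′ x y) (+-suc m d))
      (trans (arcs-suc (m + d) x y (≤-trans y<m (m≤m+n m d))) (arcs-+ m d x y y<m))

  outSoFar-suc : ∀ m x → countBelow (suc m) (arcs (suc m) x) ≡ countBelow m (arcs m x) + b2n (chosen m x)
  outSoFar-suc m x = cong₂ _+_ (countBelow-cong m (λ y → arcs-suc m x y)) (cong b2n (arcs-new m x))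

  outSoFar≤target : ∀ m x → countBelow m (arcs m x) ≤ target x
  outSoFar≤target zero    x = z≤n
  outSoFar≤target (suc m) x rewrite outSoFar-suc m x with chosen m x in e
  ... | false = ≤-trans (≤-reflexive (+-identityʳ _)) (outSoFar≤target m x)
  ... | true  = ≤-trans (≤-reflexive (+-comm _ 1))
                  (m∸n≢0⇒n<m (λ left≡0 → <⇒≢ (chosen⇒left-positive m x e) (sym left≡0)))

  left-suc : ∀ m x → left (suc m) x ≡ left m x ∸ b2n (chosen m x)
  left-suc m x =
    trans (cong (target x ∸_) (outSoFar-suc m x)) (sym (∸-+-assoc (target x) (countBelow m (arcs m x)) _))

  left-new : ∀ m → left (suc m) m ≡ target m
  left-new m = cong (target m ∸_) (trans (outSoFar-suc m m) (cong₂ _+_ unplaced (cong b2n (chosen-self m))))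
    where
    unplaced : countBelow m (arcs m m) ≡ 0
    unplaced = countBelow-false m (λ y y<m → pointwise y y<m)
      where
      pointwise : ∀ y → y < m → arcs m m y ≡ false
      pointwise y y<m with arcs m m y in e
      ... | false = refl
      ... | true  = ⊥-elim (<-asym (proj₁ (arcs⇒forward m m y e)) y<m)

  -- Since demand ≤ profile and the profiles match, the greedy choice meets every demand.
  chosen-byValue : ∀ m → Matches m (π m) → ∀ v →
    countBelow m (λ x → chosen m x ∧ (left m x ≡ᵇ suc v)) ≡ demand (π m) (suc v)
  chosen-byValue m M v =
    begin
      countBelow m (λ x → chosen m x ∧ (left m x ≡ᵇ suc v))
    ≡⟨ countBelow-cong m pointwise ⟩
      countBelow m (λ x → (left m x ≡ᵇ suc v) ∧ (countBelow x (λ y → left m y ≡ᵇ suc v) <ᵇ d))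
    ≡⟨ countBelow-first m d (λ x → left m x ≡ᵇ suc v) ⟩
      d ⊓ newProfile m (suc v)
    ≡⟨ m≤n⇒m⊓n≡m (subst (d ≤_) (sym (M v)) (demand≤profile (π m) (suc v))) ⟩
      d
    ∎
    where
    open ≡-Reasoning
    d : ℕ
    d = demand (π m) (suc v)
    pointwise : ∀ x → x < m → chosen m x ∧ (left m x ≡ᵇ suc v) ≡
      (left m x ≡ᵇ suc v) ∧ (countBelow x (λ y → left m y ≡ᵇ suc v) <ᵇ d)
    pointwise x x<m rewrite <⇒<ᵇ≡true x<m with left m x ≟ suc v
    ... | yes eq rewrite eq | ≡ᵇ-refl v = ∧-identityʳ _
    ... | no  ne rewrite ≢⇒≡ᵇ≡false ne = ∧-zeroʳ _

  chosen-zero : ∀ m → countBelow m (λ x → chosen m x ∧ (left m x ≡ᵇ 0)) ≡ 0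
  chosen-zero m = countBelow-false m pointwise
    where
    pointwise : ∀ x → x < m → chosen m x ∧ (left m x ≡ᵇ 0) ≡ false
    pointwise x _ with chosen m x in e
    ... | false = refl
    ... | true  = ≢⇒≡ᵇ≡false (λ left≡0 → <⇒≢ (chosen⇒left-positive m x e) (sym left≡0))

  chosen-total : ∀ m → π m < n → Matches m (π m) → countBelow m (chosen m) ≡ indeg (π m)
  chosen-total m t<n M =
    trans (countBelow-byValue m (π m) n (chosen m) (λ y → G y (π m)) (left m) (residual (π m))
             (λ x _ → ≤-trans (m∸n≤m (target x) (countBelow m (arcs m x))) (countBelow-≤ n (G (π x))))
             (λ y _ → countBelow-≤ n _) byValue)
          (sym (countBelow-beyond n _ (<⇒≤ t<n) (λ x → no-backward-arc)))
    where
    byValue : ∀ v → countBelow m (λ x → chosen m x ∧ (left m x ≡ᵇ v)) ≡ demand (π m) v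
    byValue zero    = trans (chosen-zero m) (sym (demand-zero t<n))
    byValue (suc v) = chosen-byValue m M v

  step : ∀ m {t} → π m ≡ t → t < n → Matches m t → Matches (suc m) (suc t)
  step m refl t<n M v =
    begin
      newProfile (suc m) (suc v)
    ≡⟨ cong₂ _+_ (countBelow-cong m (λ x _ → cong (_≡ᵇ suc v) (left-suc m x)))
                 (cong (λ r → b2n (r ≡ᵇ suc v)) (left-new m)) ⟩
      placedNew + b2n (target m ≡ᵇ suc v)
    ≡⟨ cong (_+ b2n (target m ≡ᵇ suc v)) (+-cancelʳ-≡ (demand t (suc v)) _ _ decrement) ⟩
      placedOld + b2n (outdeg t ≡ᵇ suc v)
    ≡⟨ cong₂ _+_ (countBelow-cong t (λ x _ → cong (_≡ᵇ suc v) (residual-suc x t<n)))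
                 (cong (λ r → b2n (r ≡ᵇ suc v)) (residual-self t)) ⟨
      profile (suc t) (suc v)
    ∎
    where
    open ≡-Reasoning
    t placedNew placedOld : ℕ
    t = π m
    placedNew = countBelow m (λ x → (left m x ∸ b2n (chosen m x)) ≡ᵇ suc v)
    placedOld = countBelow t (λ x → (residual t x ∸ b2n (G x t)) ≡ᵇ suc v)
    decrement : placedNew + demand t (suc v) ≡ placedOld + demand t (suc v)
    decrement =
      begin
        placedNew + demand t (suc v)
      ≡⟨ cong (placedNew +_) (chosen-byValue m M v) ⟨
        placedNew + countBelow m (λ x → chosen m x ∧ (left m x ≡ᵇ suc v))
      ≡⟨ countBelow-decrement m (left m) (chosen m) (suc v) (λ x _ → chosen⇒left-positive m x) ⟩
        newProfile m (suc v) + countBelow m (λ x → chosen m x ∧ (left m x ≡ᵇ suc (suc v)))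
      ≡⟨ cong₂ _+_ (M v) (chosen-byValue m M (suc v)) ⟩
        profile t (suc v) + demand t (suc (suc v))
      ≡⟨ countBelow-decrement t (residual t) (λ x → G x t) (suc v) (λ _ _ → residual-positive t<n) ⟨
        placedOld + demand t (suc v)
      ∎

  along-run : ∀ m t L → Matches m t → (∀ q → q < L → π (m + q) ≡ t + q) → t + L ≤ n →
    ∀ q → q ≤ L → Matches (m + q) (t + q)
  along-run m t L M consecutive t+L≤n zero    _     = subst₂ Matches (sym (+-identityʳ m)) (sym (+-identityʳ t)) M
  along-run m t L M consecutive t+L≤n (suc q) q<L =
    subst₂ Matches (sym (+-suc m q)) (sym (+-suc t q))
      (step (m + q) (consecutive q q<L) (<-≤-trans (+-monoʳ-< t q<L) t+L≤n)
        (along-run m t L M consecutive t+L≤n q (<⇒≤ q<L)))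

  outdeg-final : Matches n n → ∀ x → x < n → countBelow n (arcs n x) ≡ target x
  outdeg-final M x x<n = ≤-antisym (outSoFar≤target n x) (m∸n≡0⇒m≤n left≡0)
    where
    left≡0 : left n x ≡ 0
    left≡0 with left n x in e
    ... | zero  = refl
    ... | suc r = ⊥-elim (<⇒≢ (countBelow-positive n x x<n (trans (cong (_≡ᵇ suc r) e) (≡ᵇ-refl (suc r))))
                              (sym (trans (M r) (profile-end r))))

  indeg-final : ∀ y → y < n → π y < n → Matches y (π y) → countBelow n (λ x → arcs n x y) ≡ indeg (π y)
  indeg-final y y<n t<n M =
    begin
      countBelow n (λ x → arcs n x y)
    ≡⟨ countBelow-cong n (λ x _ → trans (cong (λ m → arcs m x y) (sym (m+[n∸m]≡n y<n)))
                                        (trans (arcs-+ (suc y) (n ∸ suc y) x y (n<1+n y)) (arcs-new y x))) ⟩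
      countBelow n (chosen y)
    ≡⟨ countBelow-beyond n (chosen y) (<⇒≤ y<n) (λ x y≤x → notLater x y≤x) ⟩
      countBelow y (chosen y)
    ≡⟨ chosen-total y t<n M ⟩
      indeg (π y)
    ∎
    where
    open ≡-Reasoning
    notLater : ∀ x → y ≤ x → chosen y x ≡ false
    notLater x y≤x with chosen y x in e
    ... | false = refl
    ... | true  = ⊥-elim (<⇒≱ (chosen⇒< y x e) y≤x)

extend : ∀ {n} → (Fin n → Bool) → ℕ → Bool
extend {zero}  f _       = false
extend {suc n} f zero    = f Fin.zero
extend {suc n} f (suc x) = extend (f ∘ Fin.suc) x

extend-toℕ : ∀ {n} (f : Fin n → Bool) u → extend f (toℕ u) ≡ f u
extend-toℕ {suc n} f Fin.zero    = refl
extend-toℕ {suc n} f (Fin.suc u) = extend-toℕ (f ∘ Fin.suc) u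

extend≡true : ∀ {n} (f : Fin n → Bool) x → extend f x ≡ true → Σ (Fin n) λ u → toℕ u ≡ x × f u ≡ true
extend≡true {suc n} f zero    e = Fin.zero , refl , e
extend≡true {suc n} f (suc x) e with extend≡true (f ∘ Fin.suc) x e
... | u , u≡x , fu = Fin.suc u , cong suc u≡x , fu

-- Total indexing, junk value (0 , 0) beyond the end.
at : List (ℕ × ℕ) → ℕ → ℕ × ℕ
at []       _       = 0 , 0
at (d ∷ ds) zero    = d
at (d ∷ ds) (suc x) = at ds x

at-lookup : ∀ ds (u : Fin (length ds)) → lookup ds u ≡ at ds (toℕ u)
at-lookup (d ∷ ds) Fin.zero    = refl
at-lookup (d ∷ ds) (Fin.suc u) = at-lookup ds u

at-++ˡ : ∀ xs ys {x} → x < length xs → at (xs ++ ys) x ≡ at xs x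
at-++ˡ (d ∷ xs) ys {zero}  _   = refl
at-++ˡ (d ∷ xs) ys {suc x} x<n = at-++ˡ xs ys (s≤s⁻¹ x<n)

at-++ʳ : ∀ xs ys x → at (xs ++ ys) (length xs + x) ≡ at ys x
at-++ʳ []       ys x = refl
at-++ʳ (d ∷ xs) ys x = at-++ʳ xs ys x

All-at : ∀ {P : ℕ × ℕ → Set} {ds} → All P ds → ∀ x → x < length ds → P (at ds x)
All-at (p All.∷ ps) zero    _   = p
All-at (p All.∷ ps) (suc x) x<n = All-at ps x (s≤s⁻¹ x<n)

toTopDag : ∀ ψ {n} → length ψ ≡ n → (H : ℕ → ℕ → Bool) → (∀ x y → H x y ≡ true → x < y) →
  (∀ y → y < n → at ψ y ≡ (countBelow n (λ x → H x y) , countBelow n (H y))) → TopDag ψ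
toTopDag ψ refl H H-forward H-degrees = record
  { arc     = λ u v → H (toℕ u) (toℕ v)
  ; forward = λ u v → H-forward (toℕ u) (toℕ v)
  ; degrees = λ v → trans (at-lookup ψ v) (trans (H-degrees (toℕ v) (toℕ<n v))
      (sym (cong₂ _,_ (count≡countBelow {length ψ} _ (λ x → H x (toℕ v)) (λ _ → refl))
                      (count≡countBelow {length ψ} _ (H (toℕ v)) (λ _ → refl)))))
  }

module ArcsOf {φ : List (ℕ × ℕ)} (D : TopDag φ) where

  n : ℕ
  n = length φ

  G : ℕ → ℕ → Bool
  G x y = extend (λ u → extend (arc D u) y) x

  G-toℕ : ∀ u w → G (toℕ u) (toℕ w) ≡ arc D u w
  G-toℕ u w = trans (extend-toℕ (λ u′ → extend (arc D u′) (toℕ w)) u) (extend-toℕ (arc D u) w)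

  G-forward : ∀ x y → G x y ≡ true → x < y
  G-forward x y e with extend≡true _ x e
  ... | u , u≡x , e′ with extend≡true _ y e′
  ...   | w , w≡y , a = subst₂ _<_ u≡x w≡y (forward D u w a)

  open Residuals n G G-forward public

  at-degrees : ∀ x → x < n → at φ x ≡ (indeg x , outdeg x)
  at-degrees x x<n =
    begin
      at φ x
    ≡⟨ cong (at φ) (toℕ-fromℕ< x<n) ⟨
      at φ (toℕ u)
    ≡⟨ at-lookup φ u ⟨
      lookup φ u
    ≡⟨ degrees D u ⟩
      (count (λ v → arc D v u) , count (arc D u))
    ≡⟨ cong₂ _,_ (count≡countBelow _ _ (λ v → sym (G-toℕ v u)))
                 (count≡countBelow _ _ (λ w → sym (G-toℕ u w))) ⟩
      (indeg (toℕ u) , outdeg (toℕ u))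
    ≡⟨ cong (λ y → (indeg y , outdeg y)) (toℕ-fromℕ< x<n) ⟩
      (indeg x , outdeg x)
    ∎
    where
    open ≡-Reasoning
    u : Fin n
    u = fromℕ< x<n

  -- Arcs into an earlier vertex from a later one do not exist, so only out-arcs count.
  potential≡atLeast : ∀ t l → t ≤ n → potential D t l ≡ atLeast t l
  potential≡atLeast t l t≤n =
    begin
      potential D t l
    ≡⟨ count≡countBelow _ F (λ u → cong (λ r → (toℕ u <ᵇ t) ∧ (l ≤ᵇ r))
         (count≡countBelow _ _ (λ w → cong₂ (λ a a′ → (a ∧ (t ≤ᵇ toℕ w)) ∨ (a′ ∧ (t ≤ᵇ toℕ w)))
                                             (sym (G-toℕ u w)) (sym (G-toℕ w u))))) ⟩
      countBelow n F
    ≡⟨ countBelow-beyond n F t≤n (λ x t≤x → cong (_∧ neighbours x) (≥⇒<ᵇ≡false {x} t≤x)) ⟩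
      countBelow t F
    ≡⟨ countBelow-cong t (λ x x<t → trans (cong (_∧ neighbours x) (<⇒<ᵇ≡true x<t))
                                          (cong (l ≤ᵇ_) (countBelow-cong n (λ y _ → outOnly x<t y)))) ⟩
      atLeast t l
    ∎
    where
    open ≡-Reasoning
    neighbours : ℕ → Bool
    neighbours x = l ≤ᵇ countBelow n (λ y → (G x y ∧ (t ≤ᵇ y)) ∨ (G y x ∧ (t ≤ᵇ y)))
    F : ℕ → Bool
    F x = (x <ᵇ t) ∧ neighbours x
    outOnly : ∀ {x} → x < t → ∀ y → ((G x y ∧ (t ≤ᵇ y)) ∨ (G y x ∧ (t ≤ᵇ y))) ≡ (G x y ∧ (t ≤ᵇ y))
    outOnly {x} x<t y with G y x in e
    ... | false = ∨-identityʳ _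
    ... | true rewrite >⇒≤ᵇ≡false (<-trans (G-forward y x e) x<t) = ∨-identityʳ _

  SamePotential⇒SameProfile : ∀ {Δ t t′} → (∀ x → x < n → outdeg x ≤ Δ) → t ≤ n → t′ ≤ n →
    SamePotential Δ D t t′ → SameProfile t t′
  SamePotential⇒SameProfile {Δ} {t} {t′} out≤Δ t≤n t′≤n samePot = sameAtLeast⇒SameProfile t t′ sameAtLeast
    where
    open ≡-Reasoning
    sameAtLeast : ∀ l → atLeast t (suc l) ≡ atLeast t′ (suc l)
    sameAtLeast l with suc l ≤? Δ
    ... | yes l<Δ =
      begin
        atLeast t (suc l)                         ≡⟨ potential≡atLeast t (suc l) t≤n ⟨
        potential D t (suc l)                     ≡⟨ cong (potential D t ∘ suc) (toℕ-fromℕ< l<Δ) ⟨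
        potential D t (suc (toℕ (fromℕ< l<Δ)))    ≡⟨ samePot (fromℕ< l<Δ) ⟩
        potential D t′ (suc (toℕ (fromℕ< l<Δ)))   ≡⟨ cong (potential D t′ ∘ suc) (toℕ-fromℕ< l<Δ) ⟩
        potential D t′ (suc l)                    ≡⟨ potential≡atLeast t′ (suc l) t′≤n ⟩
        atLeast t′ (suc l)
      ∎
    ... | no l≮Δ = trans (vanishes t≤n) (sym (vanishes t′≤n))
      where
      vanishes : ∀ {s} → s ≤ n → atLeast s (suc l) ≡ 0
      vanishes {s} s≤n = atLeast-vanishes s (suc l) (λ x x<s →
        ≤-<-trans (≤-trans (residual≤outdeg s x) (out≤Δ x (<-≤-trans x<s s≤n))) (≰⇒> l≮Δ))

∸-offset-< : ∀ {a y l} → a ≤ y → y < a + l → y ∸ a < l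
∸-offset-< {a} {y} {l} a≤y y<a+l = +-cancelˡ-< a (y ∸ a) l (subst (_< a + l) (sym (m+[n∸m]≡n a≤y)) y<a+l)

-- Positions in the reordered sequence A C B E, block lengths i = |A|, b = |B|, c = |C|.
data Block (i b c : ℕ) : ℕ → Set where
  inA : ∀ {y} → y < i → Block i b c y
  inC : ∀ {q} → q < c → Block i b c (i + q)
  inB : ∀ {q} → q < b → Block i b c (i + c + q)
  inE : ∀ q → Block i b c (i + c + b + q)

block : ∀ i b c y → Block i b c y
block i b c y with y <? i
... | yes y<i = inA y<i
... | no  y≮i with y <? i + c
...   | yes y<i+c = subst (Block i b c) (m+[n∸m]≡n (≮⇒≥ y≮i)) (inC (∸-offset-< (≮⇒≥ y≮i) y<i+c))
...   | no  y≮i+c with y <? i + c + b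
...     | yes y<i+c+b =
  subst (Block i b c) (m+[n∸m]≡n (≮⇒≥ y≮i+c)) (inB (∸-offset-< (≮⇒≥ y≮i+c) y<i+c+b))
...     | no  y≮i+c+b = subst (Block i b c) (m+[n∸m]≡n (≮⇒≥ y≮i+c+b)) (inE (y ∸ (i + c + b)))

-- The position in A B C E of the entry at position y of A C B E.
swapIndex : ℕ → ℕ → ℕ → ℕ → ℕ
swapIndex i b c y =
  if y <ᵇ i then y
  else if y <ᵇ i + c then b + y
  else if y <ᵇ i + c + b then y ∸ c
  else y

module _ (i b c : ℕ) where
  open +-*-Solver

  swapIndex-A : ∀ {y} → y < i → swapIndex i b c y ≡ y
  swapIndex-A y<i rewrite <⇒<ᵇ≡true y<i = refl

  swapIndex-C : ∀ {q} → q < c → swapIndex i b c (i + q) ≡ i + b + q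
  swapIndex-C {q} q<c rewrite ≥⇒<ᵇ≡false (m≤m+n i q) | <⇒<ᵇ≡true (+-monoʳ-< i q<c) =
    solve 3 (λ i b q → b :+ (i :+ q) := i :+ b :+ q) refl i b q

  swapIndex-B : ∀ {q} → q < b → swapIndex i b c (i + c + q) ≡ i + q
  swapIndex-B {q} q<b
    rewrite ≥⇒<ᵇ≡false (≤-trans (m≤m+n i c) (m≤m+n (i + c) q)) | ≥⇒<ᵇ≡false (m≤m+n (i + c) q)
          | <⇒<ᵇ≡true (+-monoʳ-< (i + c) q<b) =
    trans (cong (_∸ c) (solve 3 (λ i c q → i :+ c :+ q := i :+ q :+ c) refl i c q)) (m+n∸n≡m (i + q) c)

  swapIndex-E : ∀ q → swapIndex i b c (i + c + b + q) ≡ i + b + c + q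
  swapIndex-E q
    rewrite ≥⇒<ᵇ≡false (≤-trans (≤-trans (m≤m+n i c) (m≤m+n (i + c) b)) (m≤m+n (i + c + b) q))
          | ≥⇒<ᵇ≡false (≤-trans (m≤m+n (i + c) b) (m≤m+n (i + c + b) q))
          | ≥⇒<ᵇ≡false (m≤m+n (i + c + b) q) =
    solve 4 (λ i b c q → i :+ c :+ b :+ q := i :+ b :+ c :+ q) refl i b c q

at-swapBlocks : ∀ A B C E y →
  at (A ++ C ++ B ++ E) y ≡ at (A ++ B ++ C ++ E) (swapIndex (length A) (length B) (length C) y)
at-swapBlocks A B C E y with block (length A) (length B) (length C) y
... | inA y<i rewrite swapIndex-A (length A) (length B) (length C) y<i =
  trans (at-++ˡ A _ y<i) (sym (at-++ˡ A _ y<i))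
... | inC {q} q<c rewrite swapIndex-C (length A) (length B) (length C) q<c =
  begin
    at (A ++ C ++ B ++ E) (length A + q)             ≡⟨ at-++ʳ A _ q ⟩
    at (C ++ B ++ E) q                               ≡⟨ at-++ˡ C _ q<c ⟩
    at C q                                           ≡⟨ at-++ˡ C _ q<c ⟨
    at (C ++ E) q                                    ≡⟨ at-++ʳ B _ q ⟨
    at (B ++ C ++ E) (length B + q)                  ≡⟨ at-++ʳ A _ (length B + q) ⟨
    at (A ++ B ++ C ++ E) (length A + (length B + q)) ≡⟨ cong (at (A ++ B ++ C ++ E)) (+-assoc (length A) _ q) ⟨
    at (A ++ B ++ C ++ E) (length A + length B + q)
  ∎
  where open ≡-Reasoning
... | inB {q} q<b rewrite swapIndex-B (length A) (length B) (length C) q<b =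
  begin
    at (A ++ C ++ B ++ E) (length A + length C + q)   ≡⟨ cong (at (A ++ C ++ B ++ E)) (+-assoc (length A) _ q) ⟩
    at (A ++ C ++ B ++ E) (length A + (length C + q)) ≡⟨ at-++ʳ A _ (length C + q) ⟩
    at (C ++ B ++ E) (length C + q)                   ≡⟨ at-++ʳ C _ q ⟩
    at (B ++ E) q                                     ≡⟨ at-++ˡ B _ q<b ⟩
    at B q                                            ≡⟨ at-++ˡ B _ q<b ⟨
    at (B ++ C ++ E) q                                ≡⟨ at-++ʳ A _ q ⟨
    at (A ++ B ++ C ++ E) (length A + q)
  ∎
  where open ≡-Reasoning
... | inE q rewrite swapIndex-E (length A) (length B) (length C) q =
  begin
    at (A ++ C ++ B ++ E) (length A + length C + length B + q)
  ≡⟨ cong (at (A ++ C ++ B ++ E)) (solve 4 (λ a c b q → a :+ c :+ b :+ q := a :+ (c :+ (b :+ q))) refl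
                                           (length A) (length C) (length B) q) ⟩
    at (A ++ C ++ B ++ E) (length A + (length C + (length B + q)))
  ≡⟨ trans (at-++ʳ A _ _) (trans (at-++ʳ C _ _) (at-++ʳ B _ _)) ⟩
    at E q
  ≡⟨ trans (at-++ʳ A _ _) (trans (at-++ʳ B _ _) (at-++ʳ C _ _)) ⟨
    at (A ++ B ++ C ++ E) (length A + (length B + (length C + q)))
  ≡⟨ cong (at (A ++ B ++ C ++ E)) (solve 4 (λ a b c q → a :+ b :+ c :+ q := a :+ (b :+ (c :+ q))) refl
                                           (length A) (length B) (length C) q) ⟨
    at (A ++ B ++ C ++ E) (length A + length B + length C + q)
  ∎
  where
  open ≡-Reasoning
  open +-*-Solver

module BlockSwap {Δ : ℕ} (A B C E : List (ℕ × ℕ)) (D : TopDag (A ++ B ++ C ++ E))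
  (bounded : All (λ d → proj₂ d ≤ Δ) (A ++ B ++ C ++ E))
  (samePot₁ : SamePotential Δ D (length A) (length A + length B))
  (samePot₂ : SamePotential Δ D (length A + length B) (length A + length B + length C)) where

  open ArcsOf D
  i b c e j k : ℕ
  i = length A
  b = length B
  c = length C
  e = length E
  j = i + b
  k = i + b + c
  open Greedy n G G-forward (swapIndex i b c)
  open +-*-Solver

  n≡k+e : n ≡ k + e
  n≡k+e = trans (length-++ A) (trans (cong (i +_) (trans (length-++ B) (cong (b +_) (length-++ C))))
                  (solve 4 (λ i b c e → i :+ (b :+ (c :+ e)) := i :+ b :+ c :+ e) refl i b c e))

  n≡i+c+b+e : n ≡ i + c + b + e
  n≡i+c+b+e = trans n≡k+e (solve 4 (λ i b c e → i :+ b :+ c :+ e := i :+ c :+ b :+ e) refl i b c e)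

  k≤n : k ≤ n
  k≤n = ≤-trans (m≤m+n k e) (≤-reflexive (sym n≡k+e))

  j≤n : j ≤ n
  j≤n = ≤-trans (m≤m+n j c) k≤n

  i≤n : i ≤ n
  i≤n = ≤-trans (m≤m+n i b) j≤n

  out≤Δ : ∀ x → x < n → outdeg x ≤ Δ
  out≤Δ x x<n = subst (_≤ Δ) (cong proj₂ (at-degrees x x<n)) (All-at bounded x x<n)

  same₁ : SameProfile i j
  same₁ = SamePotential⇒SameProfile out≤Δ i≤n j≤n samePot₁

  same₂ : SameProfile j k
  same₂ = SamePotential⇒SameProfile out≤Δ j≤n k≤n samePot₂

  throughA : ∀ q → q ≤ i → Matches q q
  throughA = along-run 0 0 i (λ _ → refl) (λ q → swapIndex-A i b c) i≤n

  throughC : ∀ q → q ≤ c → Matches (i + q) (j + q)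
  throughC = along-run i j c (λ v → trans (throughA i ≤-refl v) (same₁ v)) (λ q → swapIndex-C i b c) k≤n

  throughB : ∀ q → q ≤ b → Matches (i + c + q) (i + q)
  throughB = along-run (i + c) i b (λ v → trans (throughC c ≤-refl v) (sym (trans (same₁ v) (same₂ v))))
                 (λ q → swapIndex-B i b c) j≤n

  throughE : ∀ q → q ≤ e → Matches (i + c + b + q) (k + q)
  throughE = along-run (i + c + b) k e (λ v → trans (throughB b ≤-refl v) (same₂ v))
                 (λ q _ → swapIndex-E i b c q) (≤-reflexive (sym n≡k+e))

  matchesEnd : Matches n n
  matchesEnd = subst₂ Matches (sym n≡i+c+b+e) (sym n≡k+e) (throughE e ≤-refl)

  reached : ∀ {y t} → swapIndex i b c y ≡ t → Matches y t → t < n →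
    Matches y (swapIndex i b c y) × swapIndex i b c y < n
  reached refl M t<n = M , t<n

  matchesAt : ∀ y → y < n → Matches y (swapIndex i b c y) × swapIndex i b c y < n
  matchesAt y y<n with block i b c y
  ... | inA y<i     = reached (swapIndex-A i b c y<i) (throughA y (<⇒≤ y<i)) y<n
  ... | inC {q} q<c = reached (swapIndex-C i b c q<c) (throughC q (<⇒≤ q<c)) (<-≤-trans (+-monoʳ-< j q<c) k≤n)
  ... | inB {q} q<b = reached (swapIndex-B i b c q<b) (throughB q (<⇒≤ q<b)) (<-≤-trans (+-monoʳ-< i q<b) j≤n)
  ... | inE q       = reached (swapIndex-E i b c q) (throughE q (<⇒≤ q<e))
                              (subst (k + q <_) (sym n≡k+e) (+-monoʳ-< k q<e))
    where
    q<e : q < e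
    q<e = +-cancelˡ-< (i + c + b) q e (subst (i + c + b + q <_) n≡i+c+b+e y<n)

  realizes : ∀ y → y < n → at (A ++ C ++ B ++ E) y ≡ (countBelow n (λ x → arcs n x y) , countBelow n (arcs n y))
  realizes y y<n =
    begin
      at (A ++ C ++ B ++ E) y
    ≡⟨ at-swapBlocks A B C E y ⟩
      at (A ++ B ++ C ++ E) (swapIndex i b c y)
    ≡⟨ at-degrees _ t<n ⟩
      (indeg (swapIndex i b c y) , target y)
    ≡⟨ cong₂ _,_ (indeg-final y y<n t<n M) (outdeg-final matchesEnd y y<n) ⟨
      (countBelow n (λ x → arcs n x y) , countBelow n (arcs n y))
    ∎
    where
    open ≡-Reasoning
    M : Matches y (swapIndex i b c y)
    M = proj₁ (matchesAt y y<n)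
    t<n : swapIndex i b c y < n
    t<n = proj₂ (matchesAt y y<n)

  swapped : TopDag (A ++ C ++ B ++ E)
  swapped = toTopDag (A ++ C ++ B ++ E) (↭-length (++⁺ˡ A (shifts C B)))
              (arcs n) (λ x y → proj₁ ∘ arcs⇒forward n x y) realizes

swapBlocks : ∀ {Δ φ} (D : TopDag φ) (A B C E : List (ℕ × ℕ)) → φ ≡ A ++ B ++ C ++ E →
  All (λ d → proj₂ d ≤ Δ) φ →
  SamePotential Δ D (length A) (length A + length B) →
  SamePotential Δ D (length A + length B) (length A + length B + length C) →
  TopDag (A ++ C ++ B ++ E)
swapBlocks D A B C E refl = BlockSwap.swapped A B C E D

segment-drop : ∀ (xs : List (ℕ × ℕ)) a b → segment xs (a + 1) b ≡ take (b ∸ a) (drop a xs)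
segment-drop xs a b rewrite m+n∸n≡m a 1 = refl

drop-split : ∀ (xs : List (ℕ × ℕ)) {a b} → a ≤ b → drop a xs ≡ take (b ∸ a) (drop a xs) ++ drop b xs
drop-split xs {a} {b} a≤b =
  trans (sym (take++drop≡id (b ∸ a) (drop a xs)))
    (cong (take (b ∸ a) (drop a xs) ++_)
      (trans (drop-drop a (b ∸ a) xs) (cong (λ d → drop d xs) (m+[n∸m]≡n a≤b))))

length-segment : ∀ (xs : List (ℕ × ℕ)) a {b} → b ≤ length xs → length (segment xs (a + 1) b) ≡ b ∸ a
length-segment xs a {b} b≤n =
  trans (cong length (segment-drop xs a b))
    (trans (length-take (b ∸ a) (drop a xs))
      (trans (cong ((b ∸ a) ⊓_) (length-drop a xs)) (m≤n⇒m⊓n≡m (∸-monoˡ-≤ a b≤n))))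

segments : ∀ (xs : List (ℕ × ℕ)) {i j k} → i ≤ j → j ≤ k → k ≤ length xs →
  xs ≡ segment xs 1 i ++ segment xs (i + 1) j ++ segment xs (j + 1) k ++ segment xs (k + 1) (length xs)
segments xs {i} {j} {k} i≤j j≤k k≤n
  rewrite segment-drop xs i j | segment-drop xs j k | segment-drop xs k (length xs)
        | take-all (length xs ∸ k) (drop k xs) (≤-reflexive (length-drop k xs)) =
  trans (drop-split xs (z≤n {i}))
    (cong (take i xs ++_) (trans (drop-split xs i≤j) (cong (take (j ∸ i) (drop i xs) ++_) (drop-split xs j≤k))))

lemma10 : (Δ : ℕ) → 1 ≤ Δ → (S : List (ℕ × ℕ)) → DegreeSequence Δ S →
          (φ : List (ℕ × ℕ)) → (R : RealizingTopOrd S φ) →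
          (i j k : ℕ) → 1 ≤ i → i < j → j < k → k ≤ length φ →
          SamePotential Δ (proj₂ R) i j → SamePotential Δ (proj₂ R) j k →
          RealizingTopOrd S
            (segment φ 1 i ++ segment φ (j + 1) k ++
             segment φ (i + 1) j ++ segment φ (k + 1) (length φ))
lemma10 Δ _ S S-bounded φ (φ↭S , D) i j k _ i<j j<k k≤n samePot-ij samePot-jk =
  ↭-trans (++⁺ˡ A (shifts C B)) (↭-trans (↭-reflexive (sym φ≡ABCE)) φ↭S) ,
  swapBlocks D A B C E φ≡ABCE (All.map proj₂ (All-resp-↭ (↭-sym φ↭S) S-bounded))
    (subst₂ (SamePotential Δ D) (sym |A|) (sym |AB|) samePot-ij)
    (subst₂ (SamePotential Δ D) (sym |AB|) (sym |ABC|) samePot-jk)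
  where
  A B C E : List (ℕ × ℕ)
  A = segment φ 1 i
  B = segment φ (i + 1) j
  C = segment φ (j + 1) k
  E = segment φ (k + 1) (length φ)
  j≤n : j ≤ length φ
  j≤n = ≤-trans (<⇒≤ j<k) k≤n
  φ≡ABCE : φ ≡ A ++ B ++ C ++ E
  φ≡ABCE = segments φ (<⇒≤ i<j) (<⇒≤ j<k) k≤n
  |A| : length A ≡ i
  |A| = length-segment φ 0 (≤-trans (<⇒≤ i<j) j≤n)
  |AB| : length A + length B ≡ j
  |AB| = trans (cong₂ _+_ |A| (length-segment φ i j≤n)) (m+[n∸m]≡n (<⇒≤ i<j))
  |ABC| : length A + length B + length C ≡ k
  |ABC| = trans (cong₂ _+_ |AB| (length-segment φ j k≤n)) (m+[n∸m]≡n (<⇒≤ j<k))
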